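{- Let $\mathcal M$ be a regular linear hypermap of type $(p,q,r)$. If $p=2$, then $\mathcal M$ is a regular medial linear hypermap; if $q=2$, then $\mathcal M$ is a regular digon linear hypermap.
   Context: For a finite group $G$ and pairwise distinct involutions $r_0,r_1,r_2$ generating $G$, $\mathcal M(G;r_0,r_1,r_2)$ is a regular linear hypermap if (1) $\langle r_1,r_2\rangle\cap\langle r_0,r_2\rangle=\langle r_2\rangle$ and (2) $\langle r_1,r_2\rangle\langle r_0,r_2\rangle\cap\langle r_0,r_2\rangle\langle r_1,r_2\rangle=\langle r_1,r_2\rangle\cup\langle r_0,r_2\rangle$; vertices, hyperedges and hyperfaces correspond to cosets of $\langle r_1,r_2\rangle,\langle r_0,r_2\rangle,\langle r_0,r_1\rangle$. Its type $(p,q,r)=(|r_1r_2|,|r_0r_2|,|r_0r_1|)$ gives the valencies of vertices (number of incident hyperedges), hyperedges and hyperfaces (number of incident vertices). For a map $M$ with simple underlying graph: the digon linear hypermap of $M$ is obtained by replacing each edge of $M$ with a digon; its hyperedges are the digons and its hyperfaces are the faces of $M$. Two edges of $M$ are contiguous if consecutive around a corner; the medial map $M^{\mathrm{med}}$ has the edges of $M$ as vertices, adjacent when contiguous. A linear hypermap is the medial linear hypermap of $M$ if its associated map (the embedded graph with faces the hyperedges and hyperfaces) is $M^{\mathrm{med}}$ and its hyperedges and hyperfaces correspond naturally to the vertices and faces of $M$. A regular medial (resp. digon) linear hypermap is a regular linear hypermap that is the medial (resp. digon) linear hypermap of some map with simple underlying graph. -}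

module Defs where

open import Data.Nat using (ℕ; zero; suc; _<_)
open import Data.List using (List; []; _∷_)
open import Data.List.Membership.Propositional using (_∈_)
open import Data.Product using (Σ; ∃; ∃-syntax; _×_; _,_)
open import Data.Sum using (_⊎_)
open import Relation.Nullary using (¬_)
open import Relation.Binary.PropositionalEquality using (_≡_; _≢_)
open import Relation.Binary.Definitions using (DecidableEquality)
open import Algebra.Structures using (IsGroup)

record FinGroup : Set₁ where
  infixl 7 _∙_
  field
    Carrier  : Set
    _∙_      : Carrier → Carrier → Carrier
    ε        : Carrier
    _⁻¹      : Carrier → Carrier
    isGroup  : IsGroup _≡_ _∙_ ε _⁻¹
    _≟_      : DecidableEquality Carrier
    elements : List Carrier
    complete : ∀ x → x ∈ elements

module _ (G : FinGroup) where
  open FinGroup G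

  data ⟨_⟩ (S : List Carrier) : Carrier → Set where
    unit : ⟨ S ⟩ ε
    gen  : ∀ {x} → x ∈ S → ⟨ S ⟩ x
    mul  : ∀ {x y} → ⟨ S ⟩ x → ⟨ S ⟩ y → ⟨ S ⟩ (x ∙ y)
    inv  : ∀ {x} → ⟨ S ⟩ x → ⟨ S ⟩ (x ⁻¹)

  _·_ : (Carrier → Set) → (Carrier → Set) → Carrier → Set
  (A · B) g = ∃[ a ] ∃[ b ] (A a × B b × g ≡ a ∙ b)

  _^_ : Carrier → ℕ → Carrier
  x ^ zero  = ε
  x ^ suc n = x ∙ (x ^ n)

  HasOrder : Carrier → ℕ → Set
  HasOrder x n = 0 < n × x ^ n ≡ ε × (∀ m → 0 < m → m < n → x ^ m ≢ ε)

  Involution : Carrier → Set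
  Involution r = r ∙ r ≡ ε × r ≢ ε

  record GenInvTriple (r₀ r₁ r₂ : Carrier) : Set where
    field
      inv₀ : Involution r₀
      inv₁ : Involution r₁
      inv₂ : Involution r₂
      d₀₁  : r₀ ≢ r₁
      d₀₂  : r₀ ≢ r₂
      d₁₂  : r₁ ≢ r₂
      generates : ∀ g → ⟨ r₀ ∷ r₁ ∷ r₂ ∷ [] ⟩ g

  record IsRegularLinearHypermap (r₀ r₁ r₂ : Carrier) : Set where
    field
      triple : GenInvTriple r₀ r₁ r₂
      cond1  : ∀ g → (⟨ r₁ ∷ r₂ ∷ [] ⟩ g × ⟨ r₀ ∷ r₂ ∷ [] ⟩ g) → ⟨ r₂ ∷ [] ⟩ g
      cond1′ : ∀ g → ⟨ r₂ ∷ [] ⟩ g → (⟨ r₁ ∷ r₂ ∷ [] ⟩ g × ⟨ r₀ ∷ r₂ ∷ [] ⟩ g)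
      cond2  : ∀ g →
        ((⟨ r₁ ∷ r₂ ∷ [] ⟩ · ⟨ r₀ ∷ r₂ ∷ [] ⟩) g × (⟨ r₀ ∷ r₂ ∷ [] ⟩ · ⟨ r₁ ∷ r₂ ∷ [] ⟩) g)
        → (⟨ r₁ ∷ r₂ ∷ [] ⟩ g ⊎ ⟨ r₀ ∷ r₂ ∷ [] ⟩ g)
      cond2′ : ∀ g → (⟨ r₁ ∷ r₂ ∷ [] ⟩ g ⊎ ⟨ r₀ ∷ r₂ ∷ [] ⟩ g) →
        ((⟨ r₁ ∷ r₂ ∷ [] ⟩ · ⟨ r₀ ∷ r₂ ∷ [] ⟩) g × (⟨ r₀ ∷ r₂ ∷ [] ⟩ · ⟨ r₁ ∷ r₂ ∷ [] ⟩) g)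

-- Flag systems: hypermaps and maps given by their flags and the three
-- flag involutions s₀ (change vertex), s₁ (change hyperedge/edge),
-- s₂ (change hyperface/face).

record FlagSystem : Set₁ where
  field
    Flag : Set
    s₀ s₁ s₂ : Flag → Flag

regHypermap : (G : FinGroup) → (r₀ r₁ r₂ : FinGroup.Carrier G) → FlagSystem
regHypermap G r₀ r₁ r₂ = record
  { Flag = Carrier ; s₀ = λ g → g ∙ r₀ ; s₁ = λ g → g ∙ r₁ ; s₂ = λ g → g ∙ r₂ }
  where open FinGroup G

module _ {F : Set} where
  data Orb (f h : F → F) : F → F → Set where
    here  : ∀ {x} → Orb f h x x
    stepf : ∀ {x y} → Orb f h x y → Orb f h x (f y)
    steph : ∀ {x y} → Orb f h x y → Orb f h x (h y)

  data Conn (f g h : F → F) : F → F → Set where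
    here  : ∀ {x} → Conn f g h x x
    stepf : ∀ {x y} → Conn f g h x y → Conn f g h x (f y)
    stepg : ∀ {x y} → Conn f g h x y → Conn f g h x (g y)
    steph : ∀ {x y} → Conn f g h x y → Conn f g h x (h y)

module _ (M : FlagSystem) where
  open FlagSystem M

  SameVertex SameEdge SameFace : Flag → Flag → Set
  SameVertex = Orb s₁ s₂
  SameEdge   = Orb s₀ s₂
  SameFace   = Orb s₀ s₁

  record IsMap : Set where
    field
      inv₀ : ∀ x → s₀ (s₀ x) ≡ x
      inv₁ : ∀ x → s₁ (s₁ x) ≡ x
      inv₂ : ∀ x → s₂ (s₂ x) ≡ x
      comm₀₂ : ∀ x → s₀ (s₂ x) ≡ s₂ (s₀ x)
      free₀ : ∀ x → s₀ x ≢ x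
      free₁ : ∀ x → s₁ x ≢ x
      free₂ : ∀ x → s₂ x ≢ x
      free₀₂ : ∀ x → s₀ (s₂ x) ≢ x
      flags : List Flag
      finite : ∀ x → x ∈ flags
      connected : ∀ x y → Conn s₀ s₁ s₂ x y

  -- the underlying graph of the map is simple: no loops, no multiple edges.
  -- The edge of flag x joins the vertex of x to the vertex of s₀ x.
  record SimpleUnderlyingGraph : Set where
    field
      noLoops : ∀ x → ¬ SameVertex x (s₀ x)
      noMultiEdges : ∀ x y → SameVertex x y → SameVertex (s₀ x) (s₀ y) → SameEdge x y

record _≅_ (H K : FlagSystem) : Set where
  open FlagSystem
  field
    to   : Flag H → Flag K
    from : Flag K → Flag H
    to∘from : ∀ y → to (from y) ≡ y
    from∘to : ∀ x → from (to x) ≡ x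
    com₀ : ∀ x → to (s₀ H x) ≡ s₀ K (to x)
    com₁ : ∀ x → to (s₁ H x) ≡ s₁ K (to x)
    com₂ : ∀ x → to (s₂ H x) ≡ s₂ K (to x)

-- Medial linear hypermap of a map M: its vertices are the edges of M,
-- its hyperedges the vertices of M, its hyperfaces the faces of M
-- (flags are the flags of M, incidence preserved).
medialHypermap : FlagSystem → FlagSystem
medialHypermap M = record { Flag = Flag ; s₀ = s₁ ; s₁ = s₀ ; s₂ = s₂ }
  where open FlagSystem M

-- Digon linear hypermap of a map M: vertices are those of M, hyperedges
-- the digons replacing the edges of M, hyperfaces the faces of M.
digonHypermap : FlagSystem → FlagSystem
digonHypermap M = record { Flag = Flag ; s₀ = s₀ ; s₁ = s₁ ; s₂ = s₂ }
  where open FlagSystem M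

-- A flag system H is a regular medial / digon linear hypermap
-- (regularity and linearity are given separately) if it is isomorphic to
-- the medial / digon linear hypermap of a map with simple underlying graph.
IsMedialOfSimpleMap : FlagSystem → Set₁
IsMedialOfSimpleMap H =
  ∃[ M ] (IsMap M × SimpleUnderlyingGraph M × (H ≅ medialHypermap M))

IsDigonOfSimpleMap : FlagSystem → Set₁
IsDigonOfSimpleMap H =
  ∃[ M ] (IsMap M × SimpleUnderlyingGraph M × (H ≅ digonHypermap M))

{-# OPTIONS --safe #-}
module Submission where

-- Right multiplication by r₀, r₁, r₂ makes G itself a flag system. If r₀r₂ has
-- order 2 then r₀ and r₂ commute, so this flag system is a map, and the hypermap
-- is its digon hypermap on the nose. Its underlying graph is simple: a loop would
-- put r₀ in ⟨r₁,r₂⟩ ∩ ⟨r₀,r₂⟩ = ⟨r₂⟩, and edges {x, x r₀}, {y, y r₀} joining the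
-- same two vertices give b r₀ = r₀ c with b = x⁻¹y, c = (x r₀)⁻¹(y r₀) ∈ ⟨r₁,r₂⟩; then b r₀ lies in
-- ⟨r₁,r₂⟩⟨r₀,r₂⟩ ∩ ⟨r₀,r₂⟩⟨r₁,r₂⟩ = ⟨r₁,r₂⟩ ∪ ⟨r₀,r₂⟩, which forces b ∈ ⟨r₀,r₂⟩,
-- i.e. the two edges coincide. The case p = 2 is the same argument with r₀ and r₁
-- exchanged: the linearity conditions are symmetric under this exchange, and the
-- medial hypermap of the exchanged map is again the hypermap itself.

open import Defs
open import Data.Nat using (ℕ)
open import Data.Product using (_×_; _,_; proj₁; proj₂)
import Data.Product as ×
open import Data.Empty using (⊥-elim)
open import Data.Sum using (_⊎_; inj₁; inj₂)
import Data.Sum as ⊎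
open import Data.List using ([]; _∷_)
open import Data.List.Relation.Unary.Any using (here; there)
open import Relation.Nullary using (¬_)
open import Function using (_∘_)
open import Relation.Binary.PropositionalEquality
open import Algebra.Bundles using (Group)
open import Algebra.Structures using (IsGroup)
import Algebra.Properties.Group as GroupProperties

module _ {F : Set} {f h : F → F} where

  orb-trans : ∀ {x y z} → Orb f h x y → Orb f h y z → Orb f h x z
  orb-trans p here      = p
  orb-trans p (stepf q) = stepf (orb-trans p q)
  orb-trans p (steph q) = steph (orb-trans p q)

  orb-sym : (∀ x → f (f x) ≡ x) → (∀ x → h (h x) ≡ x) →
            ∀ {x y} → Orb f h x y → Orb f h y x
  orb-sym ff hh here = here
  orb-sym ff hh (stepf {y = y} p) =
    orb-trans (subst (Orb f h (f y)) (ff y) (stepf here)) (orb-sym ff hh p)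
  orb-sym ff hh (steph {y = y} p) =
    orb-trans (subst (Orb f h (h y)) (hh y) (steph here)) (orb-sym ff hh p)

module _ {F : Set} {f g h : F → F} where

  conn-trans : ∀ {x y z} → Conn f g h x y → Conn f g h y z → Conn f g h x z
  conn-trans p here      = p
  conn-trans p (stepf q) = stepf (conn-trans p q)
  conn-trans p (stepg q) = stepg (conn-trans p q)
  conn-trans p (steph q) = steph (conn-trans p q)

  conn-sym : (∀ x → f (f x) ≡ x) → (∀ x → g (g x) ≡ x) → (∀ x → h (h x) ≡ x) →
             ∀ {x y} → Conn f g h x y → Conn f g h y x
  conn-sym ff gg hh here = here
  conn-sym ff gg hh (stepf {y = y} p) =
    conn-trans (subst (Conn f g h (f y)) (ff y) (stepf here)) (conn-sym ff gg hh p)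
  conn-sym ff gg hh (stepg {y = y} p) =
    conn-trans (subst (Conn f g h (g y)) (gg y) (stepg here)) (conn-sym ff gg hh p)
  conn-sym ff gg hh (steph {y = y} p) =
    conn-trans (subst (Conn f g h (h y)) (hh y) (steph here)) (conn-sym ff gg hh p)

≅-refl : ∀ {H} → H ≅ H
≅-refl = record
  { to = λ x → x ; from = λ x → x ; to∘from = λ _ → refl ; from∘to = λ _ → refl
  ; com₀ = λ _ → refl ; com₁ = λ _ → refl ; com₂ = λ _ → refl }

module _ (G : FinGroup) where
  open FinGroup G
  open IsGroup isGroup using (assoc; identityʳ; inverseˡ)

  private
    group : Group _ _
    group = record { isGroup = isGroup }

  open GroupProperties group
    using (inverseˡ-unique; ⁻¹-anti-homo-∙; ε⁻¹≈ε; identityʳ-unique;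
           \\-leftDividesˡ; \\-leftDividesʳ; //-rightDividesˡ)

  module _ {r : Carrier} (rr : r ∙ r ≡ ε) where

    involution-⁻¹ : r ⁻¹ ≡ r
    involution-⁻¹ = sym (inverseˡ-unique r r rr)

    involution-cancelʳ : ∀ x → (x ∙ r) ∙ r ≡ x
    involution-cancelʳ x = trans (assoc x r r) (trans (cong (x ∙_) rr) (identityʳ x))

    ⟨involution⟩ : ∀ {g} → ⟨ G ⟩ (r ∷ []) g → g ≡ ε ⊎ g ≡ r
    ⟨involution⟩ unit = inj₁ refl
    ⟨involution⟩ (gen (here g≡r)) = inj₂ g≡r
    ⟨involution⟩ (mul p q) with ⟨involution⟩ p | ⟨involution⟩ q
    ... | inj₁ refl | inj₁ refl = inj₁ (identityʳ ε)
    ... | inj₁ refl | inj₂ refl = inj₂ (trans (cong (_∙ r) (sym rr)) (involution-cancelʳ r))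
    ... | inj₂ refl | inj₁ refl = inj₂ (identityʳ r)
    ... | inj₂ refl | inj₂ refl = inj₁ rr
    ⟨involution⟩ (inv p) with ⟨involution⟩ p
    ... | inj₁ refl = inj₁ ε⁻¹≈ε
    ... | inj₂ refl = inj₂ involution-⁻¹

  module _ {u w : Carrier} where

    orb⇒⟨⟩ : ∀ {x y} → Orb (_∙ u) (_∙ w) x y → ⟨ G ⟩ (u ∷ w ∷ []) (x ⁻¹ ∙ y)
    orb⇒⟨⟩ {x} here = subst (⟨ G ⟩ _) (sym (inverseˡ x)) unit
    orb⇒⟨⟩ (stepf p) = subst (⟨ G ⟩ _) (assoc _ _ _) (mul (orb⇒⟨⟩ p) (gen (here refl)))
    orb⇒⟨⟩ (steph p) =
      subst (⟨ G ⟩ _) (assoc _ _ _) (mul (orb⇒⟨⟩ p) (gen (there (here refl))))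

    ⟨⟩⇒orb : u ∙ u ≡ ε → w ∙ w ≡ ε →
             ∀ {g} → ⟨ G ⟩ (u ∷ w ∷ []) g → ∀ x → Orb (_∙ u) (_∙ w) x (x ∙ g)
    ⟨⟩⇒orb uu ww unit x = subst (Orb _ _ x) (sym (identityʳ x)) here
    ⟨⟩⇒orb uu ww (gen (here refl)) x = stepf here
    ⟨⟩⇒orb uu ww (gen (there (here refl))) x = steph here
    ⟨⟩⇒orb uu ww (mul {a} {b} p q) x =
      subst (Orb _ _ x) (assoc x a b) (orb-trans (⟨⟩⇒orb uu ww p x) (⟨⟩⇒orb uu ww q (x ∙ a)))
    ⟨⟩⇒orb uu ww (inv {a} p) x =
      orb-sym (involution-cancelʳ uu) (involution-cancelʳ ww)
        (subst (Orb _ _ (x ∙ a ⁻¹)) (//-rightDividesˡ a x) (⟨⟩⇒orb uu ww p (x ∙ a ⁻¹)))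

  module _ {u v w : Carrier} (uu : u ∙ u ≡ ε) (vv : v ∙ v ≡ ε) (ww : w ∙ w ≡ ε) where

    ⟨⟩⇒conn : ∀ {g} → ⟨ G ⟩ (u ∷ v ∷ w ∷ []) g → ∀ x → Conn (_∙ u) (_∙ v) (_∙ w) x (x ∙ g)
    ⟨⟩⇒conn unit x = subst (Conn _ _ _ x) (sym (identityʳ x)) here
    ⟨⟩⇒conn (gen (here refl)) x = stepf here
    ⟨⟩⇒conn (gen (there (here refl))) x = stepg here
    ⟨⟩⇒conn (gen (there (there (here refl)))) x = steph here
    ⟨⟩⇒conn (mul {a} {b} p q) x =
      subst (Conn _ _ _ x) (assoc x a b) (conn-trans (⟨⟩⇒conn p x) (⟨⟩⇒conn q (x ∙ a)))
    ⟨⟩⇒conn (inv {a} p) x =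
      conn-sym (involution-cancelʳ uu) (involution-cancelʳ vv) (involution-cancelʳ ww)
        (subst (Conn _ _ _ (x ∙ a ⁻¹)) (//-rightDividesˡ a x) (⟨⟩⇒conn p (x ∙ a ⁻¹)))

    generated⇒connected : (∀ g → ⟨ G ⟩ (u ∷ v ∷ w ∷ []) g) →
                          ∀ x y → Conn (_∙ u) (_∙ v) (_∙ w) x y
    generated⇒connected gens x y =
      subst (Conn _ _ _ x) (\\-leftDividesˡ x y) (⟨⟩⇒conn (gens (x ⁻¹ ∙ y)) x)

  involutions-comm : ∀ {u w} → u ∙ u ≡ ε → w ∙ w ≡ ε →
                     HasOrder G (u ∙ w) 2 → u ∙ w ≡ w ∙ u
  involutions-comm {u} {w} uu ww (_ , uw² , _) = begin
    u ∙ w           ≡⟨ inverseˡ-unique (u ∙ w) (u ∙ w) uw∙uw≡ε ⟩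
    (u ∙ w) ⁻¹      ≡⟨ ⁻¹-anti-homo-∙ u w ⟩
    w ⁻¹ ∙ u ⁻¹     ≡⟨ cong₂ _∙_ (involution-⁻¹ ww) (involution-⁻¹ uu) ⟩
    w ∙ u           ∎
    where
    open ≡-Reasoning
    uw∙uw≡ε : (u ∙ w) ∙ (u ∙ w) ≡ ε
    uw∙uw≡ε = trans (cong ((u ∙ w) ∙_) (sym (identityʳ (u ∙ w)))) uw²

  ⟨⟩-swap₀₁ : ∀ {a b c g} → ⟨ G ⟩ (a ∷ b ∷ c ∷ []) g → ⟨ G ⟩ (b ∷ a ∷ c ∷ []) g
  ⟨⟩-swap₀₁ unit = unit
  ⟨⟩-swap₀₁ (gen (here refl)) = gen (there (here refl))
  ⟨⟩-swap₀₁ (gen (there (here refl))) = gen (here refl)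
  ⟨⟩-swap₀₁ (gen (there (there m))) = gen (there (there m))
  ⟨⟩-swap₀₁ (mul p q) = mul (⟨⟩-swap₀₁ p) (⟨⟩-swap₀₁ q)
  ⟨⟩-swap₀₁ (inv p) = inv (⟨⟩-swap₀₁ p)

  GenInvTriple-swap₀₁ : ∀ {r₀ r₁ r₂} → GenInvTriple G r₀ r₁ r₂ → GenInvTriple G r₁ r₀ r₂
  GenInvTriple-swap₀₁ t = record
    { inv₀ = inv₁ ; inv₁ = inv₀ ; inv₂ = inv₂
    ; d₀₁ = λ e → d₀₁ (sym e) ; d₀₂ = d₁₂ ; d₁₂ = d₀₂
    ; generates = λ g → ⟨⟩-swap₀₁ (generates g) }
    where open GenInvTriple t

  IsRegularLinearHypermap-swap₀₁ : ∀ {r₀ r₁ r₂} →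
    IsRegularLinearHypermap G r₀ r₁ r₂ → IsRegularLinearHypermap G r₁ r₀ r₂
  IsRegularLinearHypermap-swap₀₁ H = record
    { triple = GenInvTriple-swap₀₁ triple
    ; cond1  = λ g → cond1 g ∘ ×.swap
    ; cond1′ = λ g → ×.swap ∘ cond1′ g
    ; cond2  = λ g → ⊎.swap ∘ cond2 g ∘ ×.swap
    ; cond2′ = λ g → ×.swap ∘ cond2′ g ∘ ⊎.swap }
    where open IsRegularLinearHypermap H

  module _ {r₀ r₁ r₂ : Carrier} where

    regHypermap-isMap : GenInvTriple G r₀ r₁ r₂ → r₀ ∙ r₂ ≡ r₂ ∙ r₀ →
                        IsMap (regHypermap G r₀ r₁ r₂)
    regHypermap-isMap t comm = record
      { inv₀ = involution-cancelʳ (proj₁ inv₀)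
      ; inv₁ = involution-cancelʳ (proj₁ inv₁)
      ; inv₂ = involution-cancelʳ (proj₁ inv₂)
      ; comm₀₂ = λ x → begin
          (x ∙ r₂) ∙ r₀  ≡⟨ assoc x r₂ r₀ ⟩
          x ∙ (r₂ ∙ r₀)  ≡⟨ cong (x ∙_) (sym comm) ⟩
          x ∙ (r₀ ∙ r₂)  ≡⟨ sym (assoc x r₀ r₂) ⟩
          (x ∙ r₀) ∙ r₂  ∎
      ; free₀ = free (proj₂ inv₀)
      ; free₁ = free (proj₂ inv₁)
      ; free₂ = free (proj₂ inv₂)
      ; free₀₂ = λ x → free r₂∙r₀≢ε x ∘ trans (sym (assoc x r₂ r₀))
      ; flags = elements
      ; finite = complete
      ; connected = generated⇒connected (proj₁ inv₀) (proj₁ inv₁) (proj₁ inv₂) generates }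
      where
      open GenInvTriple t
      open ≡-Reasoning
      free : ∀ {r} → r ≢ ε → ∀ x → x ∙ r ≢ x
      free r≢ε x = r≢ε ∘ identityʳ-unique x _
      r₂∙r₀≢ε : r₂ ∙ r₀ ≢ ε
      r₂∙r₀≢ε e = d₀₂ (sym (trans (inverseˡ-unique r₂ r₀ e) (involution-⁻¹ (proj₁ inv₀))))

    module _ (H : IsRegularLinearHypermap G r₀ r₁ r₂) where
      open IsRegularLinearHypermap H
      open GenInvTriple triple

      r₀∉⟨r₁,r₂⟩ : ¬ ⟨ G ⟩ (r₁ ∷ r₂ ∷ []) r₀
      r₀∉⟨r₁,r₂⟩ r₀∈B with ⟨involution⟩ (proj₁ inv₂) (cond1 r₀ (r₀∈B , gen (here refl)))
      ... | inj₁ r₀≡ε = proj₂ inv₀ r₀≡ε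
      ... | inj₂ r₀≡r₂ = d₀₂ r₀≡r₂

      ⟨r₁,r₂⟩-twisted⇒⟨r₀,r₂⟩ : ∀ {b c} → ⟨ G ⟩ (r₁ ∷ r₂ ∷ []) b → ⟨ G ⟩ (r₁ ∷ r₂ ∷ []) c →
                                b ∙ r₀ ≡ r₀ ∙ c → ⟨ G ⟩ (r₀ ∷ r₂ ∷ []) b
      ⟨r₁,r₂⟩-twisted⇒⟨r₀,r₂⟩ {b} {c} b∈B c∈B twist
        with cond2 (b ∙ r₀) ( (b , r₀ , b∈B , gen (here refl) , refl)
                            , (r₀ , c , gen (here refl) , c∈B , twist))
      ... | inj₁ br₀∈B =
        ⊥-elim (r₀∉⟨r₁,r₂⟩ (subst (⟨ G ⟩ _) (\\-leftDividesʳ b r₀) (mul (inv b∈B) br₀∈B)))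
      ... | inj₂ br₀∈A =
        subst (⟨ G ⟩ _) (involution-cancelʳ (proj₁ inv₀) b) (mul br₀∈A (gen (here refl)))

      regHypermap-simple : SimpleUnderlyingGraph (regHypermap G r₀ r₁ r₂)
      regHypermap-simple = record
        { noLoops = λ x → r₀∉⟨r₁,r₂⟩ ∘ subst (⟨ G ⟩ _) (\\-leftDividesʳ x r₀) ∘ orb⇒⟨⟩
        ; noMultiEdges = λ x y xy yr₀ →
            subst (Orb _ _ x) (\\-leftDividesˡ x y)
              (⟨⟩⇒orb (proj₁ inv₀) (proj₁ inv₂)
                 (⟨r₁,r₂⟩-twisted⇒⟨r₀,r₂⟩ (orb⇒⟨⟩ xy) (orb⇒⟨⟩ yr₀) (twist x y)) x) }
        where
        open ≡-Reasoning
        r₀⁻¹≡r₀ : r₀ ⁻¹ ≡ r₀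
        r₀⁻¹≡r₀ = involution-⁻¹ (proj₁ inv₀)
        twist : ∀ x y → (x ⁻¹ ∙ y) ∙ r₀ ≡ r₀ ∙ ((x ∙ r₀) ⁻¹ ∙ (y ∙ r₀))
        twist x y = begin
          (x ⁻¹ ∙ y) ∙ r₀                  ≡⟨ assoc (x ⁻¹) y r₀ ⟩
          x ⁻¹ ∙ (y ∙ r₀)                  ≡⟨ sym (\\-leftDividesʳ r₀ _) ⟩
          r₀ ⁻¹ ∙ (r₀ ∙ (x ⁻¹ ∙ (y ∙ r₀)))  ≡⟨ cong₂ _∙_ r₀⁻¹≡r₀ refl ⟩
          r₀ ∙ (r₀ ∙ (x ⁻¹ ∙ (y ∙ r₀)))     ≡⟨ cong (r₀ ∙_) (sym (assoc r₀ (x ⁻¹) (y ∙ r₀))) ⟩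
          r₀ ∙ ((r₀ ∙ x ⁻¹) ∙ (y ∙ r₀))     ≡⟨ cong (λ z → r₀ ∙ (z ∙ (y ∙ r₀))) (sym x∙r₀⁻¹) ⟩
          r₀ ∙ ((x ∙ r₀) ⁻¹ ∙ (y ∙ r₀))     ∎
          where
          x∙r₀⁻¹ : (x ∙ r₀) ⁻¹ ≡ r₀ ∙ x ⁻¹
          x∙r₀⁻¹ = trans (⁻¹-anti-homo-∙ x r₀) (cong (_∙ x ⁻¹) r₀⁻¹≡r₀)

  module _ {r₀ r₁ r₂ : Carrier} (H : IsRegularLinearHypermap G r₀ r₁ r₂) where

    regHypermap-digon : r₀ ∙ r₂ ≡ r₂ ∙ r₀ → IsDigonOfSimpleMap (regHypermap G r₀ r₁ r₂)
    regHypermap-digon comm =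
      regHypermap G r₀ r₁ r₂ ,
      regHypermap-isMap (IsRegularLinearHypermap.triple H) comm ,
      regHypermap-simple H ,
      ≅-refl

    regHypermap-medial : r₁ ∙ r₂ ≡ r₂ ∙ r₁ → IsMedialOfSimpleMap (regHypermap G r₀ r₁ r₂)
    regHypermap-medial comm =
      regHypermap G r₁ r₀ r₂ ,
      regHypermap-isMap (IsRegularLinearHypermap.triple H′) comm ,
      regHypermap-simple H′ ,
      ≅-refl
      where
      H′ : IsRegularLinearHypermap G r₁ r₀ r₂
      H′ = IsRegularLinearHypermap-swap₀₁ H

corollary4p9 : (G : FinGroup) (r₀ r₁ r₂ : FinGroup.Carrier G) (p q r : ℕ)
    → IsRegularLinearHypermap G r₀ r₁ r₂
    → HasOrder G (FinGroup._∙_ G r₁ r₂) p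
    → HasOrder G (FinGroup._∙_ G r₀ r₂) q
    → HasOrder G (FinGroup._∙_ G r₀ r₁) r
    → (p ≡ 2 → IsMedialOfSimpleMap (regHypermap G r₀ r₁ r₂))
      × (q ≡ 2 → IsDigonOfSimpleMap (regHypermap G r₀ r₁ r₂))
corollary4p9 G r₀ r₁ r₂ p q r H o₁₂ o₀₂ _ =
    (λ p≡2 → regHypermap-medial G H
               (involutions-comm G (proj₁ inv₁) (proj₁ inv₂) (subst (HasOrder G _) p≡2 o₁₂)))
  , (λ q≡2 → regHypermap-digon G H
               (involutions-comm G (proj₁ inv₀) (proj₁ inv₂) (subst (HasOrder G _) q≡2 o₀₂)))
  where open GenInvTriple (IsRegularLinearHypermap.triple H)
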